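{- For $n$ processors, there exists a protocol solving binary Commit-Adopt against a stationary send-omission $t$-MAd adversary if and only if $t<n$.
   Context: System: $n$ processors run a synchronous round-based protocol; each round every processor sends a (possibly different) message to every processor over dedicated point-to-point channels whose receiver knows the sender identity; messages of round $\rho$ are delivered by the start of round $\rho+1$. A message adversary (MAd) sees all messages; in the send-omission type it may delete any of the outgoing messages of processors it corrupts, and it never alters internal states, inputs, outputs or incoming messages. A stationary $t$-MAd adversary corrupts at most $t$ processors in total throughout the execution. Every processor (corrupted or not) must output and the task conditions apply to all processors. Binary Commit-Adopt: each processor has an input bit and outputs $commit(v)$ or $adopt(v)$ with $v$ some processor's input; if all inputs equal $v$ all output $commit(v)$; if some processor outputs $commit(v)$ then every processor outputs $commit(v)$ or $adopt(v)$. -}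

module Defs where

open import Data.Nat using (ℕ; zero; suc; _≤_; _<_)
open import Data.Bool using (Bool; true; false; if_then_else_)
open import Data.Fin using (Fin)
open import Data.Fin.Subset using (Subset; _∈_; ∣_∣)
open import Data.Maybe using (Maybe; just; nothing)
open import Data.Product using (Σ; ∃; ∃-syntax; _×_; _,_)
open import Data.Sum using (_⊎_)
open import Relation.Binary.PropositionalEquality using (_≡_)

data CAOut : Set where
  commit : Bool → CAOut
  adopt  : Bool → CAOut

valOf : CAOut → Bool
valOf (commit v) = v
valOf (adopt v)  = v

-- A deterministic synchronous round-based protocol for n processors
-- (processors are identified by Fin n and know their own identity).
-- Each round, processor i in local state s sends message  send i s j  to
-- every processor j (possibly different messages); then it moves to a new
-- state using the vector of received messages, indexed by sender
-- (nothing = message deleted by the adversary).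
-- A processor outputs the first time  output i s  is  just o .
record Protocol (n : ℕ) : Set₁ where
  field
    State  : Set
    Msg    : Set
    init   : Fin n → Bool → State
    send   : Fin n → State → Fin n → Msg
    trans  : Fin n → State → (Fin n → Maybe Msg) → State
    output : Fin n → State → Maybe CAOut

-- A stationary send-omission t-MAd adversary: a fixed set of at most t
-- corrupted processors, and for each round r, sender i and receiver j,
-- whether the round-r message from i to j is deleted; only messages sent
-- by corrupted processors may be deleted.  (Since protocols are
-- deterministic and the adversary sees everything, adaptive strategies
-- reduce to such deletion schedules.)
record Adversary (n t : ℕ) : Set where
  field
    corrupted   : Subset n
    fewCorrupt  : ∣ corrupted ∣ ≤ t
    delete      : ℕ → Fin n → Fin n → Bool
    onlyCorrupt : ∀ r i j → delete r i j ≡ true → i ∈ corrupted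

exec : ∀ {n t} (P : Protocol n) → (Fin n → Bool) → Adversary n t →
       ℕ → Fin n → Protocol.State P
exec P inp A zero    i = Protocol.init P i (inp i)
exec P inp A (suc r) i =
  Protocol.trans P i (exec P inp A r i)
    (λ j → if Adversary.delete A r j i
             then nothing
             else just (Protocol.send P j (exec P inp A r j) i))

Decides : ∀ {n t} (P : Protocol n) → (Fin n → Bool) → Adversary n t →
          Fin n → ℕ → CAOut → Set
Decides P inp A i r o =
  Protocol.output P i (exec P inp A r i) ≡ just o
  × (∀ r′ → r′ < r → Protocol.output P i (exec P inp A r′ i) ≡ nothing)

-- P solves binary Commit-Adopt against every stationary send-omission
-- t-MAd adversary; the conditions apply to all processors.
SolvesCA : (n t : ℕ) → Protocol n → Set
SolvesCA n t P =
  ∀ (inp : Fin n → Bool) (A : Adversary n t) →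
    (∀ i → ∃[ r ] ∃[ o ] Decides P inp A i r o)
    × (∀ i r o → Decides P inp A i r o → ∃[ j ] inp j ≡ valOf o)
    × (∀ v → (∀ j → inp j ≡ v) → ∀ i r o → Decides P inp A i r o → o ≡ commit v)
    × (∀ i j r r′ v o → Decides P inp A i r (commit v) → Decides P inp A j r′ o →
         o ≡ commit v ⊎ o ≡ adopt v)

-- If t ≥ n the adversary may silence every processor, so each processor's run depends on its
-- own input alone.  Processor 0 with input 1 then behaves as in the all-1 run and commits 1,
-- processor 1 with input 0 behaves as in the all-0 run and commits 0, and both happen in the
-- run with inputs 1,0,0,…, violating agreement.
--
-- If t < n, two rounds suffice.  In round 1 everyone broadcasts its input, and a processor is
-- clean when every value it receives equals its own.  In round 2 clean processors broadcast
-- their value; a processor commits when it is clean and every round-2 message it receives is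
-- its own value, and otherwise adopts the value of some received round-2 message, or its own
-- input if there is none.  Some processor c is correct, so all its messages arrive: every
-- clean processor shares c's input, a committer has heard c broadcast its value in round 2,
-- so c is clean, and then every processor hears that value and adopts or commits it.
module Submission where

open import Defs
open import Data.Nat using (ℕ; _<_)
open import Data.Product using (Σ-syntax)
open import Function.Bundles using (_⇔_)

open import Data.Bool using (Bool; true; false; _∧_; if_then_else_)
import Data.Bool.Properties as Bool
open import Data.Empty using (⊥; ⊥-elim)
open import Data.Fin using (Fin; zero; suc)
open import Data.Fin.Properties using (all?)
open import Data.Fin.Subset using (Subset; inside; outside; ⊤; _∉_; ∣_∣)
open import Data.Fin.Subset.Properties using (∈⊤; ∣⊤∣≡n; drop-there)
open import Data.Maybe using (Maybe; just; nothing; fromMaybe; _<∣>_)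
open import Data.Maybe.Effectful using (join)
open import Data.Maybe.Properties using (just-injective; ≡-dec)
open import Data.Maybe.Relation.Unary.All as All using (All; drop-just)
open import Data.Nat using (suc; _≤_; s≤s)
open import Data.Nat.Properties using (≤-trans; _<?_; ≮⇒≥)
open import Data.Product using (∃-syntax; _×_; _,_; proj₁; proj₂; map)
open import Data.Sum using (_⊎_; inj₁; inj₂)
open import Data.Vec using (_∷_)
open import Function using (_∘_; id; const)
open import Function.Bundles using (mk⇔)
open import Relation.Nullary using (¬_; Dec; yes; no; does)
open import Relation.Nullary.Decidable using (dec-true; decidable-stable)
open import Relation.Binary.PropositionalEquality using (_≡_; refl; sym; trans; cong; subst)

∣p∣<n⇒∃∉p : ∀ {n} (p : Subset n) → ∣ p ∣ < n → ∃[ x ] x ∉ p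
∣p∣<n⇒∃∉p (outside ∷ p) _ = zero , λ ()
∣p∣<n⇒∃∉p (inside ∷ p) (s≤s ∣p∣<n) = map suc (_∘ drop-there) (∣p∣<n⇒∃∉p p ∣p∣<n)

firstJust : ∀ {n} {A : Set} → (Fin n → Maybe A) → Maybe A
firstJust {ℕ.zero} f = nothing
firstJust {suc n} f = f zero <∣> firstJust (f ∘ suc)

firstJust-sound : ∀ {n} {A : Set} (f : Fin n → Maybe A) {a : A} →
                  firstJust f ≡ just a → ∃[ k ] f k ≡ just a
firstJust-sound {suc n} f eq with f zero in f0
... | just _ = zero , trans f0 eq
... | nothing = map suc id (firstJust-sound (f ∘ suc) eq)

firstJust-complete : ∀ {n} {A : Set} (f : Fin n → Maybe A) {k : Fin n} {a : A} →
                     f k ≡ just a → ∃[ b ] firstJust f ≡ just b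
firstJust-complete {suc n} f {zero} fk rewrite fk = _ , refl
firstJust-complete {suc n} f {suc k} fk with f zero
... | just b = b , refl
... | nothing = firstJust-complete (f ∘ suc) fk

-- A round-1 message is the sender's input; a round-2 message is just v if the sender is clean
-- with value v, and nothing otherwise.
Msg : Set
Msg = Maybe Bool

Supports : Bool → Maybe Msg → Set
Supports b = All (_≡ just b)

Unanimous : ∀ {n} → Bool → (Fin n → Maybe Msg) → Set
Unanimous b m = ∀ j → Supports b (m j)

-- Opaque: otherwise  does (unanimous? b m)  unfolds before a proof can abstract over it with  with .
opaque
  unanimous? : ∀ {n} (b : Bool) (m : Fin n → Maybe Msg) → Dec (Unanimous b m)
  unanimous? b m = all? (λ j → All.dec (λ x → ≡-dec Bool._≟_ x (just b)) (m j))

data Phase : Set where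
  proposing : Bool → Phase
  checking  : Bool → Bool → Phase
  decided   : CAOut → Phase

adoptValue : ∀ {n} → Bool → (Fin n → Maybe Msg) → Bool
adoptValue b m = fromMaybe b (firstJust (join ∘ m))

decide : ∀ {n} → Bool → Bool → (Fin n → Maybe Msg) → CAOut
decide b clean m = if clean ∧ does (unanimous? b m) then commit b else adopt (adoptValue b m)

message : Phase → Msg
message (proposing b)      = just b
message (checking b clean) = if clean then just b else nothing
message (decided _)        = nothing

step : ∀ {n} → Phase → (Fin n → Maybe Msg) → Phase
step (proposing b)      m = checking b (does (unanimous? b m))
step (checking b clean) m = decided (decide b clean m)
step (decided o)        _ = decided o

result : Phase → Maybe CAOut
result (decided o) = just o
result _           = nothing

commitAdopt : ∀ n → Protocol n
commitAdopt n = record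
  { State  = Phase
  ; Msg    = Msg
  ; init   = λ _ → proposing
  ; send   = λ _ s _ → message s
  ; trans  = λ _ → step
  ; output = λ _ → result
  }

decide-unanimous : ∀ {n} {b} {m : Fin n → Maybe Msg} → Unanimous b m → decide b true m ≡ commit b
decide-unanimous {b = b} {m} u rewrite dec-true (unanimous? b m) u = refl

decide-commit : ∀ {n} {b c v} (m : Fin n → Maybe Msg) →
                decide b c m ≡ commit v → b ≡ v × c ≡ true × Unanimous b m
decide-commit {b = b} {true} m eq with unanimous? b m | eq
... | yes u | refl = refl , refl , u
... | no _  | ()
decide-commit {c = false} m ()

decide-adopt : ∀ {n} {b c w} (m : Fin n → Maybe Msg) → decide b c m ≡ adopt w → w ≡ adoptValue b m
decide-adopt {b = b} {true} m eq with unanimous? b m | eq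
... | yes _ | ()
... | no _  | refl = refl
decide-adopt {c = false} m refl = refl

adoptValue-origin : ∀ {n} b (m : Fin n → Maybe Msg) →
                    adoptValue b m ≡ b ⊎ ∃[ k ] join (m k) ≡ just (adoptValue b m)
adoptValue-origin b m with firstJust (join ∘ m) in eq
... | just _  = inj₂ (firstJust-sound (join ∘ m) eq)
... | nothing = inj₁ refl

adoptValue-heard : ∀ {n} b (m : Fin n → Maybe Msg) {k u} →
                   join (m k) ≡ just u → ∃[ k′ ] join (m k′) ≡ just (adoptValue b m)
adoptValue-heard b m mk with firstJust (join ∘ m) in eq | firstJust-complete (join ∘ m) mk
... | just _ | _ = firstJust-sound (join ∘ m) eq
... | nothing | _ , ()

module CommitAdoptRun {n t} (inp : Fin n → Bool) (A : Adversary n t) where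
  open Adversary A

  P : Protocol n
  P = commitAdopt n

  received : ℕ → Fin n → Fin n → Maybe Msg
  received r j i = if delete r j i then nothing else just (message (exec P inp A r j))

  clean : Fin n → Bool
  clean i = does (unanimous? (inp i) (λ j → received 0 j i))

  out : Fin n → CAOut
  out i = decide (inp i) (clean i) (λ j → received 1 j i)

  exec-decided : ∀ r i → exec P inp A (suc (suc r)) i ≡ decided (out i)
  exec-decided ℕ.zero i = refl
  exec-decided (suc r) i rewrite exec-decided r i = refl

  decides⇒out : ∀ {i r o} → Decides P inp A i r o → o ≡ out i
  decides⇒out {r = ℕ.zero} (() , _)
  decides⇒out {r = suc ℕ.zero} (() , _)
  decides⇒out {i} {suc (suc r)} (d , _) = just-injective (trans (sym d) (cong result (exec-decided r i)))

  decides-out : ∀ i → Decides P inp A i 2 (out i)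
  decides-out i = refl , λ { ℕ.zero _ → refl ; (suc ℕ.zero) _ → refl ; (suc (suc _)) (s≤s (s≤s ())) }

  heard-clean : ∀ {k i w} → join (received 1 k i) ≡ just w → inp k ≡ w × clean k ≡ true
  heard-clean {k} {i} eq with delete 1 k i | clean k | eq
  ... | false | true | refl = refl , refl
  ... | false | false | ()
  ... | true  | _     | ()

  out-valid : ∀ i → ∃[ j ] inp j ≡ valOf (out i)
  out-valid i with out i in eq
  ... | commit v = i , proj₁ (decide-commit _ eq)
  ... | adopt w rewrite decide-adopt _ eq with adoptValue-origin (inp i) (λ j → received 1 j i)
  ...   | inj₁ w≡inp = i , sym w≡inp
  ...   | inj₂ (k , heard) = k , proj₁ (heard-clean heard)

  module Unanimity (v : Bool) (all-v : ∀ j → inp j ≡ v) where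
    all-clean : ∀ k → clean k ≡ true
    all-clean k = dec-true (unanimous? (inp k) (λ j → received 0 j k)) supports
      where
      supports : ∀ j → Supports (inp k) (received 0 j k)
      supports j with delete 0 j k
      ... | true  = All.nothing
      ... | false = All.just (cong just (trans (all-v j) (sym (all-v k))))

    second-round-unanimous : ∀ i → Unanimous (inp i) (λ j → received 1 j i)
    second-round-unanimous i j with delete 1 j i
    ... | true  = All.nothing
    ... | false rewrite all-clean j = All.just (cong just (trans (all-v j) (sym (all-v i))))

    out-unanimous : ∀ i → out i ≡ commit v
    out-unanimous i rewrite all-clean i =
      trans (decide-unanimous (second-round-unanimous i)) (cong commit (all-v i))

  module Agreement {c} (c-correct : c ∉ corrupted) where
    received-correct : ∀ r i → received r c i ≡ just (message (exec P inp A r c))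
    received-correct r i with delete r c i in eq
    ... | true  = ⊥-elim (c-correct (onlyCorrupt r c i eq))
    ... | false = refl

    clean⇒inp≡ : ∀ {i} → clean i ≡ true → inp i ≡ inp c
    clean⇒inp≡ {i} h with unanimous? (inp i) (λ j → received 0 j i) | h
    ... | yes u | _ =
      sym (just-injective (drop-just (subst (Supports (inp i)) (received-correct 0 i) (u c))))
    ... | no _  | ()

    -- The committer's unanimity check covers c's round-2 message, which was delivered.
    commit⇒correct-broadcasts : ∀ {i v} → out i ≡ commit v → ∀ j → join (received 1 c j) ≡ just v
    commit⇒correct-broadcasts {i} eq j with decide-commit _ eq
    ... | refl , _ , u = trans (cong join (received-correct 1 j))
                           (drop-just (subst (Supports (inp i)) (received-correct 1 i) (u c)))

    commit⇒inp-c : ∀ {i v} → out i ≡ commit v → inp c ≡ v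
    commit⇒inp-c eq = proj₁ (heard-clean (commit⇒correct-broadcasts eq c))

    heard⇒inp-c : ∀ {k j w} → join (received 1 k j) ≡ just w → w ≡ inp c
    heard⇒inp-c heard = trans (sym (proj₁ (heard-clean heard))) (clean⇒inp≡ (proj₂ (heard-clean heard)))

    out-agreement : ∀ {i v} → out i ≡ commit v → ∀ j → out j ≡ commit v ⊎ out j ≡ adopt v
    out-agreement eq j with out j in eqⱼ
    ... | commit w with refl , cleanⱼ , _ ← decide-commit _ eqⱼ =
      inj₁ (cong commit (trans (clean⇒inp≡ cleanⱼ) (commit⇒inp-c eq)))
    ... | adopt w
      with k , heard ← adoptValue-heard (inp j) (λ k → received 1 k j) (commit⇒correct-broadcasts eq j) =
      inj₂ (cong adopt (trans (decide-adopt _ eqⱼ) (trans (heard⇒inp-c {k} heard) (commit⇒inp-c eq))))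

commitAdopt-solves : ∀ {n t} → t < n → SolvesCA n t (commitAdopt n)
commitAdopt-solves {n} t<n inp A =
    (λ i → 2 , out i , decides-out i)
  , (λ i r o d → subst (λ o → ∃[ j ] inp j ≡ valOf o) (sym (decides⇒out d)) (out-valid i))
  , (λ v all-v i r o d → trans (decides⇒out d) (Unanimity.out-unanimous v all-v i))
  , λ i j r r′ v o dᵢ dⱼ →
      subst (λ o → o ≡ commit v ⊎ o ≡ adopt v) (sym (decides⇒out dⱼ))
        (Agreement.out-agreement (proj₂ correct) (sym (decides⇒out dᵢ)) j)
  where
  open CommitAdoptRun inp A
  correct : ∃[ c ] c ∉ Adversary.corrupted A
  correct = ∣p∣<n⇒∃∉p _ (≤-trans (s≤s (Adversary.fewCorrupt A)) t<n)

module Silenced {n t} (P : Protocol n) (n≤t : n ≤ t) where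
  silencing : Adversary n t
  silencing = record
    { corrupted   = ⊤
    ; fewCorrupt  = subst (_≤ t) (sym (∣⊤∣≡n n)) n≤t
    ; delete      = λ _ _ _ → true
    ; onlyCorrupt = λ _ _ _ _ → ∈⊤
    }

  silenced-exec : ∀ {inp inp′ : Fin n → Bool} {i} → inp i ≡ inp′ i →
                  ∀ r → exec P inp silencing r i ≡ exec P inp′ silencing r i
  silenced-exec {i = i} eq ℕ.zero = cong (Protocol.init P i) eq
  silenced-exec {inp} {inp′} {i} eq (suc r) =
    cong (λ s → Protocol.trans P i s (λ _ → nothing)) (silenced-exec {inp} {inp′} eq r)

  silenced-decides : ∀ {inp inp′ : Fin n → Bool} {i r o} → inp i ≡ inp′ i →
                     Decides P inp silencing i r o → Decides P inp′ silencing i r o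
  silenced-decides {inp} {inp′} {i} {r} eq (d , before) =
      trans (cong (Protocol.output P i) (sym (silenced-exec {inp} {inp′} eq r))) d
    , λ r′ r′<r →
        trans (cong (Protocol.output P i) (sym (silenced-exec {inp} {inp′} eq r′))) (before r′ r′<r)

unsolvable : ∀ {n t} (P : Protocol n) → 1 < n → n ≤ t → ¬ SolvesCA n t P
unsolvable {suc (suc m)} P (s≤s (s≤s _)) n≤t solves = disagreement
  where
  open Silenced P n≤t
  split : Fin (suc (suc m)) → Bool
  split zero    = true
  split (suc _) = false
  disagreement : ⊥
  disagreement
    with r₀ , o₀ , d₀ ← proj₁ (solves (const true) silencing) zero
       | r₁ , o₁ , d₁ ← proj₁ (solves (const false) silencing) (suc zero)
    with refl ← proj₁ (proj₂ (proj₂ (solves (const true) silencing))) true (λ _ → refl) zero r₀ o₀ d₀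
       | refl ← proj₁ (proj₂ (proj₂ (solves (const false) silencing))) false (λ _ → refl) (suc zero) r₁ o₁ d₁
    with proj₂ (proj₂ (proj₂ (solves split silencing))) zero (suc zero) r₀ r₁ true (commit false)
           (silenced-decides {const true} refl d₀) (silenced-decides {const false} refl d₁)
  ... | inj₁ ()
  ... | inj₂ ()

theorem4p4 : (n t : ℕ) → 1 < n →
    (Σ[ P ∈ Protocol n ] SolvesCA n t P) ⇔ t < n
theorem4p4 n t 1<n = mk⇔
  (λ (P , solves) → decidable-stable (t <? n) (λ t≮n → unsolvable P 1<n (≮⇒≥ t≮n) solves))
  (λ t<n → commitAdopt n , commitAdopt-solves t<n)
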